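{- Let $(G,T)$ be a terminal network and let $Z\subseteq E(G)$ be a cut-covering set for edge cuts over $T$. Then $Z$ is a 2-approximate multicut-covering set for $(G,T)$.
   Context: Graphs are undirected; $(G,T)$ is a graph $G$ with terminal set $T\subseteq V(G)$. A cut-covering set for $(G,T)$ is a set $Z\subseteq E(G)$ such that for every partition $T=A\cup B$ there is a minimum $(A,B)$-edge cut $X$ in $G$ with $X\subseteq Z$. For a set of cut requests $R\subseteq\binom{T}{2}$, a multicut for $R$ is a set $X\subseteq E(G)$ such that every connected component of $G-X$ contains at most one member of each pair in $R$; for a partition $\mathcal{T}$ of $T$, a multiway cut for $\mathcal{T}$ is a set $X\subseteq E(G)$ such that every component of $G-X$ contains terminals of at most one part. $Z$ is a 2-approximate multicut-covering set if for every partition $\mathcal{T}$ of $T$ (equivalently, for every $R\subseteq\binom{T}{2}$) there is a multiway cut for $\mathcal{T}$ (respectively multicut for $R$) contained in $Z$ whose size is at most twice the minimum size of such a cut in $G$. -}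

module Defs where

open import Data.Nat using (ℕ; _≤_; _*_)
open import Data.Fin using (Fin)
open import Data.Fin.Subset using (Subset; _∈_; _∉_; _⊆_; ∣_∣)
open import Data.Product using (_×_; _,_; proj₁; proj₂; ∃-syntax)
open import Relation.Binary.PropositionalEquality using (_≡_; _≢_)
open import Relation.Nullary using (¬_)
open import Data.Sum using (_⊎_)
open import Data.List using (List)
open import Data.List.Membership.Propositional using () renaming (_∈_ to _∈ₗ_)

record Graph (n m : ℕ) : Set where
  field
    endpoints : Fin m → Fin n × Fin n

open Graph public

EdgeSet : ℕ → Set
EdgeSet m = Subset m

data Conn {n m : ℕ} (G : Graph n m) (X : EdgeSet m) : Fin n → Fin n → Set where
  here  : ∀ {u} → Conn G X u u
  fwd   : ∀ {u w v} (e : Fin m) → e ∉ X → endpoints G e ≡ (u , w) → Conn G X w v → Conn G X u v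
  bwd   : ∀ {u w v} (e : Fin m) → e ∉ X → endpoints G e ≡ (w , u) → Conn G X w v → Conn G X u v

IsCut : ∀ {n m} → Graph n m → Subset n → Subset n → EdgeSet m → Set
IsCut G A B X = ∀ a b → a ∈ A → b ∈ B → ¬ Conn G X a b

IsMinCut : ∀ {n m} → Graph n m → Subset n → Subset n → EdgeSet m → Set
IsMinCut G A B X = IsCut G A B X × (∀ Y → IsCut G A B Y → ∣ X ∣ ≤ ∣ Y ∣)

-- Partitions T = A ∪ B (A, B disjoint) correspond to subsets A ⊆ T with B = T \ A.
IsCutCovering : ∀ {n m} → Graph n m → Subset n → EdgeSet m → Set
IsCutCovering {n} {m} G T Z =
  ∀ (A B : Subset n) → A ⊆ T → B ⊆ T → (∀ t → t ∈ T → (t ∈ A × t ∉ B) ⊎ (t ∈ B × t ∉ A)) →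
  ∃[ X ] (X ⊆ Z × IsMinCut G A B X)

-- A partition of T is given by a labelling ℓ of the vertices with k labels,
-- whose restriction to T determines the parts (every partition of T arises so).
IsMultiwayCut : ∀ {n m k} → Graph n m → Subset n → (Fin n → Fin k) → EdgeSet m → Set
IsMultiwayCut G T ℓ X = ∀ s t → s ∈ T → t ∈ T → ℓ s ≢ ℓ t → ¬ Conn G X s t

IsRequestSet : ∀ {n} → Subset n → List (Fin n × Fin n) → Set
IsRequestSet T R = ∀ s t → (s , t) ∈ₗ R → s ∈ T × t ∈ T × s ≢ t

IsMulticut : ∀ {n m} → Graph n m → List (Fin n × Fin n) → EdgeSet m → Set
IsMulticut G R X = ∀ s t → (s , t) ∈ₗ R → ¬ Conn G X s t

Is2ApproxMulticutCovering : ∀ {n m} → Graph n m → Subset n → EdgeSet m → Set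
Is2ApproxMulticutCovering {n} {m} G T Z =
  (∀ (k : ℕ) (ℓ : Fin n → Fin k) →
     ∃[ X ] (X ⊆ Z × IsMultiwayCut G T ℓ X ×
             (∀ Y → IsMultiwayCut G T ℓ Y → ∣ X ∣ ≤ 2 * ∣ Y ∣)))
  ×
  (∀ (R : List (Fin n × Fin n)) → IsRequestSet T R →
     ∃[ X ] (X ⊆ Z × IsMulticut G R X ×
             (∀ Y → IsMulticut G R Y → ∣ X ∣ ≤ 2 * ∣ Y ∣)))

-- For a labelling ℓ of the terminals, cover each label class i by a minimum
-- isolating cut (class i against all other terminals) taken from Z; their union
-- is a multiway cut inside Z.  If Y is any multiway cut, the Y-edges incident to
-- the region of G − Y reached from class i form an isolating cut for i, and every
-- edge of Y is incident to at most two regions, since each endpoint lies in at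
-- most one.  Summing, the union costs at most 2 ∣ Y ∣.  A multicut problem reduces
-- to this: label the vertices by the components of G − Y* for a minimum multicut
-- Y*; a multiway cut for this labelling is a multicut, and Y* is one of them.
module Submission where

open import Defs
open import Data.Nat.Properties
  using (+-*-semiring; +-mono-≤; ≤-refl; ≤-reflexive; ≤-trans; ≤-<-trans; ≰⇒>; <⇒≱; m≤m+n; m≤n+m;
         *-identityʳ; *-zeroʳ; *-monoʳ-≤; module ≤-Reasoning)
open import Algebra.Properties.Semiring.Sum +-*-semiring
  using (sum; sum-syntax; ∑-comm; ∑-distrib-+; sum-cong-≗; sum-replicate-zero; *-distribˡ-sum)
open import Data.Bool.Base using (Bool; true; false)
open import Data.Empty using (⊥-elim)
open import Data.Fin using (Fin; zero; suc; inject₁; _≟_)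
open import Data.Fin.Properties using (any?; inject₁-injective; suc-injective; 0≢1+n)
open import Data.Fin.Subset using (Subset; _∈_; _∉_; _⊆_; ∣_∣; inside; outside; ⊤; ⁅_⁆)
open import Data.Fin.Subset.Properties using (_∈?_; ∈⊤; ∣p∣≤n; p⊂q⇒∣p∣<∣q∣; anySubset?; ⊆-antisym; x∈⁅x⁆; x∈⁅y⁆⇒x≡y)
import Data.List.Relation.Unary.All as All
open import Data.Nat using (ℕ; zero; suc; _+_; _*_; _≤_; _<_; z≤n; s≤s; _≤?_)
open import Data.Nat.GeneralisedArithmetic using (fold)
open import Data.Product using (_×_; _,_; proj₁; proj₂; ∃; ∃-syntax)
open import Data.Product.Properties using (≡-dec)
open import Data.Sum using (_⊎_; inj₁; inj₂) renaming (map to ⊎-map)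
open import Data.Vec using ([]; _∷_; lookup; tabulate; here; there)
open import Data.Vec.Properties using ([]=⇒lookup; lookup⇒[]=; lookup∘tabulate)
open import Function using (_∘_; case_of_)
open import Relation.Binary.PropositionalEquality using (_≡_; _≢_; refl; sym; trans; cong; subst)
open import Relation.Nullary using (Dec; yes; no; does)
open import Relation.Nullary.Decidable using (_×-dec_; _⊎-dec_; ¬?; dec-true; dec-false; decidable-stable; map′)
open import Relation.Unary using (Pred; Decidable)

private
  variable
    k n m : ℕ

𝟙 : Bool → ℕ
𝟙 true = 1
𝟙 false = 0

∣p∣≡∑𝟙 : (p : Subset n) → ∣ p ∣ ≡ ∑[ x < n ] 𝟙 (lookup p x)
∣p∣≡∑𝟙 [] = refl
∣p∣≡∑𝟙 (inside ∷ p) = cong suc (∣p∣≡∑𝟙 p)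
∣p∣≡∑𝟙 (outside ∷ p) = ∣p∣≡∑𝟙 p

𝟙-does : ∀ {a} {A : Set a} (a? : Dec A) → A → 𝟙 (does a?) ≡ 1
𝟙-does a? a = cong 𝟙 (dec-true a? a)

𝟙-∈ : ∀ {x} {p : Subset n} → x ∈ p → 𝟙 (lookup p x) ≡ 1
𝟙-∈ x∈p = cong 𝟙 ([]=⇒lookup x∈p)

𝟙-≤ : ∀ (p : Subset n) x {c} → (x ∈ p → 1 ≤ c) → 𝟙 (lookup p x) ≤ c
𝟙-≤ p x x∈p⇒1≤c with lookup p x in eq
... | true = x∈p⇒1≤c (lookup⇒[]= x p eq)
... | false = z≤n

∑-mono-≤ : {f g : Fin k → ℕ} → (∀ i → f i ≤ g i) → sum f ≤ sum g
∑-mono-≤ {zero} _ = z≤n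
∑-mono-≤ {suc k} f≤g = +-mono-≤ (f≤g zero) (∑-mono-≤ (f≤g ∘ suc))

∑-≤0 : {f : Fin k → ℕ} → (∀ i → f i ≤ 0) → sum f ≤ 0
∑-≤0 {k} f≤0 = ≤-trans (∑-mono-≤ f≤0) (≤-reflexive (sum-replicate-zero k))

term≤∑ : (f : Fin k → ℕ) (i : Fin k) → f i ≤ sum f
term≤∑ f zero = m≤m+n _ _
term≤∑ f (suc i) = ≤-trans (term≤∑ (f ∘ suc) i) (m≤n+m _ _)

∑𝟙-unique≤1 : ∀ {p} {P : Pred (Fin k) p} (P? : Decidable P) →
  (∀ {i j} → P i → P j → i ≡ j) → ∑[ i < k ] 𝟙 (does (P? i)) ≤ 1
∑𝟙-unique≤1 {zero} P? unique = z≤n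
∑𝟙-unique≤1 {suc k} P? unique with P? zero
... | yes P0 = s≤s (∑-≤0 λ i → ≤-reflexive (cong 𝟙 (dec-false (P? (suc i)) (0≢1+n ∘ unique P0))))
... | no _ = ∑𝟙-unique≤1 (P? ∘ suc) (λ Pi Pj → suc-injective (unique Pi Pj))

multiplicity : (Fin k → Subset m) → Fin m → ℕ
multiplicity {k} F e = ∑[ i < k ] 𝟙 (lookup (F i) e)

∑∣F∣≡∑multiplicity : (F : Fin k → Subset m) →
  ∑[ i < k ] ∣ F i ∣ ≡ ∑[ e < m ] multiplicity F e
∑∣F∣≡∑multiplicity F =
  trans (sum-cong-≗ (∣p∣≡∑𝟙 ∘ F)) (∑-comm (λ i e → 𝟙 (lookup (F i) e)))

∣p∣≤∑∣F∣ : (F : Fin k → Subset m) {p : Subset m} →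
  (∀ {e} → e ∈ p → ∃[ i ] e ∈ F i) → ∣ p ∣ ≤ ∑[ i < k ] ∣ F i ∣
∣p∣≤∑∣F∣ {k} {m} F {p} covered = begin
  ∣ p ∣                            ≡⟨ ∣p∣≡∑𝟙 p ⟩
  ∑[ e < m ] 𝟙 (lookup p e)        ≤⟨ ∑-mono-≤ (λ e → 𝟙-≤ p e (1≤multiplicity ∘ covered)) ⟩
  ∑[ e < m ] multiplicity F e      ≡⟨ ∑∣F∣≡∑multiplicity F ⟨
  ∑[ i < k ] ∣ F i ∣               ∎
  where
  open ≤-Reasoning
  1≤multiplicity : ∀ {e} → ∃[ i ] e ∈ F i → 1 ≤ multiplicity F e
  1≤multiplicity {e} (i , e∈Fi) =
    subst (_≤ multiplicity F e) (𝟙-∈ e∈Fi) (term≤∑ (λ j → 𝟙 (lookup (F j) e)) i)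

∑∣F∣≤c*∣p∣ : (F : Fin k → Subset m) {p : Subset m} (c : ℕ) → (∀ i → F i ⊆ p) →
  (∀ {e} → e ∈ p → multiplicity F e ≤ c) → ∑[ i < k ] ∣ F i ∣ ≤ c * ∣ p ∣
∑∣F∣≤c*∣p∣ {k} {m} F {p} c F⊆p bounded = begin
  ∑[ i < k ] ∣ F i ∣               ≡⟨ ∑∣F∣≡∑multiplicity F ⟩
  ∑[ e < m ] multiplicity F e      ≤⟨ ∑-mono-≤ pointwise ⟩
  ∑[ e < m ] (c * 𝟙 (lookup p e))  ≡⟨ *-distribˡ-sum c (λ e → 𝟙 (lookup p e)) ⟨
  c * ∑[ e < m ] 𝟙 (lookup p e)    ≡⟨ cong (c *_) (∣p∣≡∑𝟙 p) ⟨
  c * ∣ p ∣                        ∎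
  where
  open ≤-Reasoning
  pointwise : ∀ e → multiplicity F e ≤ c * 𝟙 (lookup p e)
  pointwise e with lookup p e in eq
  ... | true = subst (multiplicity F e ≤_) (sym (*-identityʳ c)) (bounded (lookup⇒[]= e p eq))
  ... | false = subst (multiplicity F e ≤_) (sym (*-zeroʳ c))
    (∑-≤0 λ i → 𝟙-≤ (F i) e (⊥-elim ∘ e∉p ∘ F⊆p i))
    where
    e∉p : e ∉ p
    e∉p e∈p = case trans (sym ([]=⇒lookup e∈p)) eq of λ ()

subset : ∀ {p} {P : Pred (Fin n) p} → Decidable P → Subset n
subset P? = tabulate (does ∘ P?)

∈-subset⁺ : ∀ {p} {P : Pred (Fin n) p} (P? : Decidable P) {x} → P x → x ∈ subset P?
∈-subset⁺ P? {x} Px = lookup⇒[]= x _ (trans (lookup∘tabulate _ x) (dec-true (P? x) Px))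

∈-subset⁻ : ∀ {p} {P : Pred (Fin n) p} (P? : Decidable P) {x} → x ∈ subset P? → P x
∈-subset⁻ P? {x} x∈ with P? x | trans (sym (lookup∘tabulate _ x)) ([]=⇒lookup x∈)
... | yes Px | _ = Px
... | no _ | ()

∃-minimum : ∀ {q} {Q : Pred (Subset m) q} → Decidable Q → ∃ Q →
  ∃[ x ] (Q x × (∀ y → Q y → ∣ x ∣ ≤ ∣ y ∣))
∃-minimum {Q = Q} Q? (w , Qw) = descend ∣ w ∣ (w , Qw , ≤-refl)
  where
  descend : ∀ c → ∃[ y ] (Q y × ∣ y ∣ ≤ c) → ∃[ x ] (Q x × (∀ y → Q y → ∣ x ∣ ≤ ∣ y ∣))
  descend zero (y , Qy , ∣y∣≤0) = y , Qy , λ _ _ → ≤-trans ∣y∣≤0 z≤n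
  descend (suc c) (y , Qy , ∣y∣≤1+c) with anySubset? (λ y → Q? y ×-dec (∣ y ∣ ≤? c))
  ... | yes smaller = descend c smaller
  ... | no ∄smaller =
    y , Qy , λ y′ Qy′ → ≤-trans ∣y∣≤1+c (≰⇒> λ ∣y′∣≤c → ∄smaller (y′ , Qy′ , ∣y′∣≤c))

first : Subset n → Fin (suc n)
first [] = zero
first (inside ∷ p) = zero
first (outside ∷ p) = suc (first p)

first-∈ : ∀ {p : Subset n} {x} → x ∈ p → ∃[ y ] (first p ≡ inject₁ y × y ∈ p)
first-∈ {p = inside ∷ p} _ = zero , refl , here
first-∈ {p = outside ∷ p} (there x∈p) with first-∈ x∈p
... | y , eq , y∈p = suc y , cong suc eq , there y∈p

module _ (f : Subset n → Subset n) (inflationary : ∀ p → p ⊆ f p) where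

  ⊆-fold : ∀ p j → p ⊆ fold p f j
  ⊆-fold p zero = λ x∈p → x∈p
  ⊆-fold p (suc j) = inflationary _ ∘ ⊆-fold p j

  fixed-or-grows : ∀ q → f q ⊆ q ⊎ ∣ q ∣ < ∣ f q ∣
  fixed-or-grows q with any? (λ x → (x ∈? f q) ×-dec ¬? (x ∈? q))
  ... | yes (x , x∈fq , x∉q) = inj₂ (p⊂q⇒∣p∣<∣q∣ (inflationary q , x , x∈fq , x∉q))
  ... | no ∄new = inj₁ λ {x} x∈fq → decidable-stable (x ∈? q) (λ x∉q → ∄new (x , x∈fq , x∉q))

  fixed-or-large : ∀ p j → (∃[ i ] f (fold p f i) ⊆ fold p f i) ⊎ j ≤ ∣ fold p f j ∣
  fixed-or-large p zero = inj₂ z≤n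
  fixed-or-large p (suc j) with fixed-or-large p j | fixed-or-grows (fold p f j)
  ... | inj₁ fixed | _ = inj₁ fixed
  ... | inj₂ _ | inj₁ fixed = inj₁ (j , fixed)
  ... | inj₂ j≤ | inj₂ grows = inj₂ (≤-<-trans j≤ grows)

  fold-reaches-fixpoint : ∀ p → ∃[ j ] f (fold p f j) ⊆ fold p f j
  fold-reaches-fixpoint p with fixed-or-large p (suc n)
  ... | inj₁ fixed = fixed
  ... | inj₂ large = ⊥-elim (<⇒≱ large (∣p∣≤n (fold p f (suc n))))

module Connectivity (G : Graph n m) where

  Adjacent : EdgeSet m → Fin n → Fin n → Set
  Adjacent X a b = ∃[ e ] (e ∉ X × (endpoints G e ≡ (a , b) ⊎ endpoints G e ≡ (b , a)))

  adjacent? : ∀ X a b → Dec (Adjacent X a b)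
  adjacent? X a b = any? λ e → ¬? (e ∈? X) ×-dec
    (endpoints G e ≟² (a , b) ⊎-dec endpoints G e ≟² (b , a))
    where _≟²_ = ≡-dec _≟_ _≟_

  Conn-cons : ∀ {X u w v} → Adjacent X u w → Conn G X w v → Conn G X u v
  Conn-cons (e , e∉X , inj₁ eq) w~v = fwd e e∉X eq w~v
  Conn-cons (e , e∉X , inj₂ eq) w~v = bwd e e∉X eq w~v

  Conn-snoc : ∀ {X u w v} → Conn G X u w → Adjacent X w v → Conn G X u v
  Conn-snoc here adj = Conn-cons adj here
  Conn-snoc (fwd e e∉X eq c) adj = fwd e e∉X eq (Conn-snoc c adj)
  Conn-snoc (bwd e e∉X eq c) adj = bwd e e∉X eq (Conn-snoc c adj)

  Conn-sym : ∀ {X u v} → Conn G X u v → Conn G X v u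
  Conn-sym here = here
  Conn-sym (fwd e e∉X eq c) = Conn-snoc (Conn-sym c) (e , e∉X , inj₂ eq)
  Conn-sym (bwd e e∉X eq c) = Conn-snoc (Conn-sym c) (e , e∉X , inj₁ eq)

  Conn-trans : ∀ {X u w v} → Conn G X u w → Conn G X w v → Conn G X u v
  Conn-trans here d = d
  Conn-trans (fwd e e∉X eq c) d = fwd e e∉X eq (Conn-trans c d)
  Conn-trans (bwd e e∉X eq c) d = bwd e e∉X eq (Conn-trans c d)

  Conn-antimono : ∀ {X X′ u v} → X ⊆ X′ → Conn G X′ u v → Conn G X u v
  Conn-antimono X⊆X′ here = here
  Conn-antimono X⊆X′ (fwd e e∉X′ eq c) = fwd e (e∉X′ ∘ X⊆X′) eq (Conn-antimono X⊆X′ c)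
  Conn-antimono X⊆X′ (bwd e e∉X′ eq c) = bwd e (e∉X′ ∘ X⊆X′) eq (Conn-antimono X⊆X′ c)

  Conn-⊤⇒≡ : ∀ {u v} → Conn G ⊤ u v → u ≡ v
  Conn-⊤⇒≡ here = refl
  Conn-⊤⇒≡ (fwd e e∉⊤ _ _) = ⊥-elim (e∉⊤ ∈⊤)
  Conn-⊤⇒≡ (bwd e e∉⊤ _ _) = ⊥-elim (e∉⊤ ∈⊤)

  Conn-confined : ∀ {Y W : EdgeSet m} {s v} →
    (∀ {e} → e ∈ Y → Conn G Y s (proj₁ (endpoints G e)) ⊎ Conn G Y s (proj₂ (endpoints G e)) → e ∈ W) →
    Conn G W s v → Conn G Y s v
  Conn-confined {Y} {W} {s} boundary⊆W = extend here
    where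
    extend : ∀ {p v} → Conn G Y s p → Conn G W p v → Conn G Y s v
    extend s~p here = s~p
    extend s~p (fwd e e∉W eq p~v) with e ∈? Y
    ... | yes e∈Y = ⊥-elim (e∉W (boundary⊆W e∈Y (inj₁ (subst (Conn G Y s) (sym (cong proj₁ eq)) s~p))))
    ... | no e∉Y = extend (Conn-snoc s~p (e , e∉Y , inj₁ eq)) p~v
    extend s~p (bwd e e∉W eq p~v) with e ∈? Y
    ... | yes e∈Y = ⊥-elim (e∉W (boundary⊆W e∈Y (inj₂ (subst (Conn G Y s) (sym (cong proj₂ eq)) s~p))))
    ... | no e∉Y = extend (Conn-snoc s~p (e , e∉Y , inj₂ eq)) p~v

  InOrAdjacentTo : EdgeSet m → Subset n → Fin n → Set
  InOrAdjacentTo X p b = b ∈ p ⊎ ∃[ a ] (a ∈ p × Adjacent X a b)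

  inOrAdjacentTo? : ∀ X p → Decidable (InOrAdjacentTo X p)
  inOrAdjacentTo? X p b = b ∈? p ⊎-dec any? λ a → (a ∈? p) ×-dec adjacent? X a b

  expand : EdgeSet m → Subset n → Subset n
  expand X p = subset (inOrAdjacentTo? X p)

  ⊆-expand : ∀ X p → p ⊆ expand X p
  ⊆-expand X p x∈p = ∈-subset⁺ (inOrAdjacentTo? X p) (inj₁ x∈p)

  reach : EdgeSet m → Fin n → ℕ → Subset n
  reach X u = fold ⁅ u ⁆ (expand X)

  reach-sound : ∀ X u j {v} → v ∈ reach X u j → Conn G X u v
  reach-sound X u zero v∈ with x∈⁅y⁆⇒x≡y u v∈
  ... | refl = here
  reach-sound X u (suc j) v∈ with ∈-subset⁻ (inOrAdjacentTo? X (reach X u j)) v∈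
  ... | inj₁ v∈reach = reach-sound X u j v∈reach
  ... | inj₂ (a , a∈reach , a~v) = Conn-snoc (reach-sound X u j a∈reach) a~v

  expand-closed : ∀ {X p u v} → expand X p ⊆ p → u ∈ p → Conn G X u v → v ∈ p
  expand-closed closed u∈p here = u∈p
  expand-closed {X} {p} closed u∈p (fwd e e∉X eq c) =
    expand-closed closed (closed (∈-subset⁺ (inOrAdjacentTo? X p) (inj₂ (_ , u∈p , e , e∉X , inj₁ eq)))) c
  expand-closed {X} {p} closed u∈p (bwd e e∉X eq c) =
    expand-closed closed (closed (∈-subset⁺ (inOrAdjacentTo? X p) (inj₂ (_ , u∈p , e , e∉X , inj₂ eq)))) c

  Conn? : ∀ X u v → Dec (Conn G X u v)
  Conn? X u v with fold-reaches-fixpoint (expand X) (⊆-expand X) ⁅ u ⁆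
  ... | j , closed with v ∈? reach X u j
  ...   | yes v∈ = yes (reach-sound X u j v∈)
  ...   | no v∉ = no λ u~v → v∉ (expand-closed closed (⊆-fold (expand X) (⊆-expand X) _ j (x∈⁅x⁆ u)) u~v)

  component : EdgeSet m → Fin n → Subset n
  component X v = subset λ u → Conn? X u v

  -- Equal components are equal vectors, so a canonical element of the
  -- component serves as a label.
  componentLabel : EdgeSet m → Fin n → Fin (suc n)
  componentLabel X = first ∘ component X

  Conn⇒same-label : ∀ {X s t} → Conn G X s t → componentLabel X s ≡ componentLabel X t
  Conn⇒same-label {X} {s} {t} s~t = cong first (⊆-antisym
    (λ u∈ → ∈-subset⁺ (connectedTo t) (Conn-trans (∈-subset⁻ (connectedTo s) u∈) s~t))
    (λ u∈ → ∈-subset⁺ (connectedTo s) (Conn-trans (∈-subset⁻ (connectedTo t) u∈) (Conn-sym s~t))))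
    where connectedTo = λ v u → Conn? X u v

  same-label⇒Conn : ∀ {X s t} → componentLabel X s ≡ componentLabel X t → Conn G X s t
  same-label⇒Conn {X} {s} {t} same
    with first-∈ (∈-subset⁺ (λ u → Conn? X u s) here) | first-∈ (∈-subset⁺ (λ u → Conn? X u t) here)
  ... | y , eq , y∈ | y′ , eq′ , y′∈ with inject₁-injective (trans (sym eq) (trans same eq′))
  ... | refl = Conn-trans (Conn-sym (∈-subset⁻ (λ u → Conn? X u s) y∈)) (∈-subset⁻ (λ u → Conn? X u t) y′∈)

module IsolatingCuts (G : Graph n m) (T : Subset n) (ℓ : Fin n → Fin k) where
  open Connectivity G

  labelled? : ∀ i → Decidable (λ t → t ∈ T × ℓ t ≡ i)
  labelled? i t = (t ∈? T) ×-dec (ℓ t ≟ i)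

  unlabelled? : ∀ i → Decidable (λ t → t ∈ T × ℓ t ≢ i)
  unlabelled? i t = (t ∈? T) ×-dec ¬? (ℓ t ≟ i)

  labelled unlabelled : Fin k → Subset n
  labelled i = subset (labelled? i)
  unlabelled i = subset (unlabelled? i)

  labelled-partition : ∀ i t → t ∈ T →
    (t ∈ labelled i × t ∉ unlabelled i) ⊎ (t ∈ unlabelled i × t ∉ labelled i)
  labelled-partition i t t∈T with ℓ t ≟ i
  ... | yes ℓt≡i = inj₁ (∈-subset⁺ (labelled? i) (t∈T , ℓt≡i) ,
                         λ t∈ → proj₂ (∈-subset⁻ (unlabelled? i) t∈) ℓt≡i)
  ... | no ℓt≢i = inj₂ (∈-subset⁺ (unlabelled? i) (t∈T , ℓt≢i) ,
                        λ t∈ → ℓt≢i (proj₂ (∈-subset⁻ (labelled? i) t∈)))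

  isolatingCut : ∀ {Z} → IsCutCovering G T Z → ∀ i →
    ∃[ X ] (X ⊆ Z × IsMinCut G (labelled i) (unlabelled i) X)
  isolatingCut cover i = cover (labelled i) (unlabelled i)
    (proj₁ ∘ ∈-subset⁻ (labelled? i)) (proj₁ ∘ ∈-subset⁻ (unlabelled? i)) (labelled-partition i)

  Reached : EdgeSet m → Fin k → Fin n → Set
  Reached Y i v = ∃[ s ] (s ∈ T × ℓ s ≡ i × Conn G Y s v)

  reached? : ∀ Y i → Decidable (Reached Y i)
  reached? Y i v = any? λ s → (s ∈? T) ×-dec ((ℓ s ≟ i) ×-dec Conn? Y s v)

  Touches : EdgeSet m → Fin k → Fin m → Set
  Touches Y i e = e ∈ Y × (Reached Y i (proj₁ (endpoints G e)) ⊎ Reached Y i (proj₂ (endpoints G e)))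

  touches? : ∀ Y i → Decidable (Touches Y i)
  touches? Y i e = (e ∈? Y) ×-dec (reached? Y i (proj₁ (endpoints G e)) ⊎-dec reached? Y i (proj₂ (endpoints G e)))

  boundary : EdgeSet m → Fin k → EdgeSet m
  boundary Y i = subset (touches? Y i)

  module _ {Y} (Y-multiway : IsMultiwayCut G T ℓ Y) where

    reached-unique : ∀ {v i j} → Reached Y i v → Reached Y j v → i ≡ j
    reached-unique {i = i} {j} (s , s∈T , ℓs≡i , s~v) (s′ , s′∈T , ℓs′≡j , s′~v) =
      decidable-stable (i ≟ j) λ i≢j →
        Y-multiway s s′ s∈T s′∈T (λ ℓs≡ℓs′ → i≢j (trans (sym ℓs≡i) (trans ℓs≡ℓs′ ℓs′≡j)))
          (Conn-trans s~v (Conn-sym s′~v))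

    boundary-isolates : ∀ i → IsCut G (labelled i) (unlabelled i) (boundary Y i)
    boundary-isolates i a b a∈ b∈ a~b
      with ∈-subset⁻ (labelled? i) a∈ | ∈-subset⁻ (unlabelled? i) b∈
    ... | a∈T , ℓa≡i | b∈T , ℓb≢i =
      Y-multiway a b a∈T b∈T (λ ℓa≡ℓb → ℓb≢i (trans (sym ℓa≡ℓb) ℓa≡i))
        (Conn-confined (λ e∈Y touch → ∈-subset⁺ (touches? Y i) (e∈Y , ⊎-map fromA fromA touch)) a~b)
      where
      fromA : ∀ {v} → Conn G Y a v → Reached Y i v
      fromA a~v = a , a∈T , ℓa≡i , a~v

    boundary-multiplicity≤2 : ∀ e → multiplicity (boundary Y) e ≤ 2
    boundary-multiplicity≤2 e = begin
      ∑[ i < k ] 𝟙 (lookup (boundary Y i) e)                 ≤⟨ ∑-mono-≤ one-endpoint ⟩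
      ∑[ i < k ] (𝟙 (does (reached? Y i p)) + 𝟙 (does (reached? Y i q)))
                                                              ≡⟨ ∑-distrib-+ (λ i → 𝟙 (does (reached? Y i p))) (λ i → 𝟙 (does (reached? Y i q))) ⟩
      ∑[ i < k ] 𝟙 (does (reached? Y i p)) + ∑[ i < k ] 𝟙 (does (reached? Y i q))
                                                              ≤⟨ +-mono-≤ (∑𝟙-unique≤1 (λ i → reached? Y i p) reached-unique)
                                                                          (∑𝟙-unique≤1 (λ i → reached? Y i q) reached-unique) ⟩
      2                                                       ∎
      where
      open ≤-Reasoning
      p = proj₁ (endpoints G e)
      q = proj₂ (endpoints G e)
      one-endpoint : ∀ i → 𝟙 (lookup (boundary Y i) e) ≤ 𝟙 (does (reached? Y i p)) + 𝟙 (does (reached? Y i q))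
      one-endpoint i = 𝟙-≤ (boundary Y i) e λ e∈ → case proj₂ (∈-subset⁻ (touches? Y i) e∈) of λ where
        (inj₁ reached-p) → ≤-trans (≤-reflexive (sym (𝟙-does (reached? Y i p) reached-p))) (m≤m+n _ _)
        (inj₂ reached-q) → ≤-trans (≤-reflexive (sym (𝟙-does (reached? Y i q) reached-q))) (m≤n+m _ _)

    ∑∣boundary∣≤2∣Y∣ : ∑[ i < k ] ∣ boundary Y i ∣ ≤ 2 * ∣ Y ∣
    ∑∣boundary∣≤2∣Y∣ = ∑∣F∣≤c*∣p∣ (boundary Y) 2 (λ i → proj₁ ∘ ∈-subset⁻ (touches? Y i))
      (λ {e} _ → boundary-multiplicity≤2 e)

  multiwayCut-2approx : ∀ {Z} → IsCutCovering G T Z →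
    ∃[ X ] (X ⊆ Z × IsMultiwayCut G T ℓ X × (∀ Y → IsMultiwayCut G T ℓ Y → ∣ X ∣ ≤ 2 * ∣ Y ∣))
  multiwayCut-2approx {Z} cover = X , X⊆Z , X-multiway , X-bound
    where
    cut : Fin k → EdgeSet m
    cut i = proj₁ (isolatingCut cover i)

    inSomeCut? : Decidable (λ e → ∃[ i ] e ∈ cut i)
    inSomeCut? e = any? λ i → e ∈? cut i

    X : EdgeSet m
    X = subset inSomeCut?

    X⊆Z : X ⊆ Z
    X⊆Z e∈X with ∈-subset⁻ inSomeCut? e∈X
    ... | i , e∈cut = proj₁ (proj₂ (isolatingCut cover i)) e∈cut

    X-multiway : IsMultiwayCut G T ℓ X
    X-multiway s t s∈T t∈T ℓs≢ℓt s~t =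
      proj₁ (proj₂ (proj₂ (isolatingCut cover (ℓ s)))) s t
        (∈-subset⁺ (labelled? (ℓ s)) (s∈T , refl)) (∈-subset⁺ (unlabelled? (ℓ s)) (t∈T , ℓs≢ℓt ∘ sym))
        (Conn-antimono (λ e∈cut → ∈-subset⁺ inSomeCut? (ℓ s , e∈cut)) s~t)

    X-bound : ∀ Y → IsMultiwayCut G T ℓ Y → ∣ X ∣ ≤ 2 * ∣ Y ∣
    X-bound Y Y-multiway = begin
      ∣ X ∣                           ≤⟨ ∣p∣≤∑∣F∣ cut (∈-subset⁻ inSomeCut?) ⟩
      ∑[ i < k ] ∣ cut i ∣            ≤⟨ ∑-mono-≤ cut≤boundary ⟩
      ∑[ i < k ] ∣ boundary Y i ∣     ≤⟨ ∑∣boundary∣≤2∣Y∣ Y-multiway ⟩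
      2 * ∣ Y ∣                       ∎
      where
      open ≤-Reasoning
      cut≤boundary : ∀ i → ∣ cut i ∣ ≤ ∣ boundary Y i ∣
      cut≤boundary i = proj₂ (proj₂ (proj₂ (isolatingCut cover i))) (boundary Y i) (boundary-isolates Y-multiway i)

module Multicuts (G : Graph n m) (T : Subset n) where
  open Connectivity G

  multicut? : ∀ R X → Dec (IsMulticut G R X)
  multicut? R X = map′ (λ all s t → All.lookup all) (λ X-multicut → All.tabulate (X-multicut _ _))
    (All.all? (λ st → ¬? (Conn? X (proj₁ st) (proj₂ st))) R)

  module _ {R} (requests : IsRequestSet T R) where

    ⊤-multicut : IsMulticut G R ⊤
    ⊤-multicut s t st∈R s~t = proj₂ (proj₂ (requests s t st∈R)) (Conn-⊤⇒≡ s~t)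

    components-multiway : ∀ Y → IsMultiwayCut G T (componentLabel Y) Y
    components-multiway Y s t _ _ ℓs≢ℓt s~t = ℓs≢ℓt (Conn⇒same-label s~t)

    multiway⇒multicut : ∀ {X Y} → IsMulticut G R Y → IsMultiwayCut G T (componentLabel Y) X → IsMulticut G R X
    multiway⇒multicut Y-multicut X-multiway s t st∈R =
      X-multiway s t (proj₁ (requests s t st∈R)) (proj₁ (proj₂ (requests s t st∈R)))
        (Y-multicut s t st∈R ∘ same-label⇒Conn)

    multicut-2approx : ∀ {Z} → IsCutCovering G T Z →
      ∃[ X ] (X ⊆ Z × IsMulticut G R X × (∀ Y → IsMulticut G R Y → ∣ X ∣ ≤ 2 * ∣ Y ∣))
    multicut-2approx cover =
      let Y* , Y*-multicut , Y*-minimum = ∃-minimum (multicut? R) (⊤ , ⊤-multicut)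
          X , X⊆Z , X-multiway , X-bound = IsolatingCuts.multiwayCut-2approx G T (componentLabel Y*) cover
      in X , X⊆Z , multiway⇒multicut Y*-multicut X-multiway ,
         λ Y Y-multicut → ≤-trans (X-bound Y* (components-multiway Y*)) (*-monoʳ-≤ 2 (Y*-minimum Y Y-multicut))

lemma5 : ∀ {n m : ℕ} (G : Graph n m) (T : Subset n) (Z : EdgeSet m) →
    IsCutCovering G T Z → Is2ApproxMulticutCovering G T Z
lemma5 G T Z cover =
  (λ k ℓ → IsolatingCuts.multiwayCut-2approx G T ℓ cover) ,
  (λ R requests → Multicuts.multicut-2approx G T requests cover)
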